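{- For every Diophantine triple $\{a,b,c\}$ there exists a unique nonnegative integer $D<\frac{\log(abc)}{\log 12}$ such that $d_{ -(D+1)}(a,b,c)=0$.
   Context: A Diophantine triple is a set of three distinct positive integers such that the product of any two of them increased by $1$ is a perfect square. For a Diophantine triple $\{a,b,c\}$ put $d_{\pm}(a,b,c)=a+b+c+2abc\pm 2\sqrt{(ab+1)(ac+1)(bc+1)}$. An Euler triple is a Diophantine triple of the form $\{a,b,a+b+2\sqrt{ab+1}\}$. For a Diophantine triple $T=\{a,b,c\}$ which is not an Euler triple, $\partial(T)$ is the set obtained from $\{a,b,c,d_-(a,b,c)\}$ by removing its largest element $\max(a,b,c)$. Define $\partial_0(T)=T$ and, provided $\partial_{ -(D-1)}(T)$ is not an Euler triple, $\partial_{ -D}(T)=\partial(\partial_{ -(D-1)}(T))$ for $D\ge1$. Finally $d_{ -D}(a,b,c)=d_-(\partial_{ -D+1}(\{a,b,c\}))$ (so $d_{ -1}(a,b,c)=d_-(a,b,c)$). -}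

module Defs where

open import Data.Nat using (ℕ; zero; suc)
open import Data.Integer using (ℤ; +_; _+_; _-_; _*_; _≤_; _<_; _≤?_)
open import Data.Bool using (Bool; true; false; _∧_; if_then_else_)
open import Data.Product using (Σ; ∃; _×_; _,_)
open import Data.Sum using (_⊎_)
open import Relation.Nullary using (¬_; does)
open import Relation.Binary.PropositionalEquality using (_≡_; _≢_)

-- A (possibly unordered) triple of integers, represented as an ordered triple.
Triple : Set
Triple = ℤ × ℤ × ℤ

IsSquare : ℤ → Set
IsSquare x = ∃ λ r → r * r ≡ x

IsDiophTriple : Triple → Set
IsDiophTriple (a , b , c) =
  (+ 0 < a) × (+ 0 < b) × (+ 0 < c) ×
  (a ≢ b) × (a ≢ c) × (b ≢ c) ×
  IsSquare (a * b + + 1) × IsSquare (a * c + + 1) × IsSquare (b * c + + 1)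

DMinus : Triple → ℤ → Set
DMinus (a , b , c) d =
  ∃ λ m → (+ 0 ≤ m) × (m * m ≡ (a * b + + 1) * (a * c + + 1) * (b * c + + 1)) ×
          (d ≡ a + b + c + + 2 * a * b * c - + 2 * m)

EulerForm : ℤ → ℤ → ℤ → Set
EulerForm x y z = ∃ λ r → (+ 0 ≤ r) × (r * r ≡ x * y + + 1) × (z ≡ x + y + + 2 * r)

-- Euler triple: a Diophantine triple of the form {x, y, x+y+2√(xy+1)}
-- (as a set, so any of the three entries may play the role of the third).
IsEuler : Triple → Set
IsEuler (a , b , c) =
  IsDiophTriple (a , b , c) ×
  (EulerForm a b c ⊎ EulerForm a c b ⊎ EulerForm b c a)

removeMax : Triple → ℤ → Triple
removeMax (a , b , c) d =
  if does (b ≤? a) ∧ does (c ≤? a) then (b , c , d)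
  else if does (a ≤? b) ∧ does (c ≤? b) then (a , c , d)
  else (a , b , d)

-- Descent D T T' : ∂_{-D}(T) is defined and equals T'.
-- ∂_{-(D+1)}(T) = ∂(∂_{-D}(T)) is defined when ∂_{-D}(T) is not an Euler triple
-- (and d₋(∂_{-D}(T)) exists).
data Descent : ℕ → Triple → Triple → Set where
  here : ∀ {T} → Descent zero T T
  step : ∀ {D T T' d} → Descent D T T' → ¬ IsEuler T' → DMinus T' d →
         Descent (suc D) T (removeMax T' d)

-- d_{-(D+1)}(T) = d₋(∂_{-D}(T)) is defined and equals d.
DMinusIter : ℕ → Triple → ℤ → Set
DMinusIter D T d = ∃ λ T' → Descent D T T' × DMinus T' d

{-# OPTIONS --safe #-}
module Submission where

-- Let r, s, t ≥ 0 be the roots of ab+1, ac+1, bc+1. Then d = d₋(a,b,c) = a+b+c+2abc−2rst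
-- satisfies ad+1 = (at−rs)² (and symmetrically), and d·d₊ = a²+b²+c²−2ab−2ac−2bc−4,
-- a quantity that vanishes exactly on Euler triples. Hence d ≥ 0, with d = 0 precisely for
-- Euler triples; otherwise replacing the largest element c by d gives a Diophantine triple,
-- and d < c/(4ab) ≤ c/12 makes its product at least 12 times smaller. The descent is
-- deterministic and cannot continue past an Euler triple, which gives uniqueness; since the
-- product of a Diophantine triple exceeds 1, an Euler triple is reached after D steps with
-- 12^D < abc.

open import Defs
open import Data.Nat as ℕ using (ℕ; zero; suc; s≤s; z≤n; _^_)
import Data.Nat.Properties as ℕ
open import Data.Integer using (ℤ; +_; -[1+_]; _+_; _-_; _*_; -_; _≤_; _<_; _≤?_; +≤+; +<+; -≤-; ∣_∣; nonNegative; positive)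
import Data.Integer.Properties as ℤ
open import Data.Integer.Tactic.RingSolver using (solve)
open import Data.List using ([]; _∷_)
open import Data.Product using (Σ; ∃; _×_; _,_; proj₁)
open import Data.Sum using (_⊎_; inj₁; inj₂; [_,_]′)
open import Function using (id)
open import Data.Empty using (⊥; ⊥-elim)
open import Relation.Nullary using (¬_; yes; no)
open import Relation.Binary.Definitions using (tri<; tri≈; tri>)
open import Relation.Binary.PropositionalEquality
open ≡-Reasoning

0≤i*i : ∀ i → + 0 ≤ i * i
0≤i*i (+ n)    = subst (+ 0 ≤_) (ℤ.pos-* n n) (+≤+ z≤n)
0≤i*i -[1+ n ] = +≤+ z≤n

0≤i*j : ∀ {i j} → + 0 ≤ i → + 0 ≤ j → + 0 ≤ i * j
0≤i*j {j = j} 0≤i 0≤j = ℤ.*-monoʳ-≤-nonNeg j {{nonNegative 0≤j}} 0≤i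

0<i*j : ∀ {i j} → + 0 < i → + 0 < j → + 0 < i * j
0<i*j {j = j} 0<i 0<j = ℤ.*-monoʳ-<-pos j {{positive 0<j}} 0<i

0<i*j⇒0<i : ∀ {i j} → + 0 < i * j → + 0 < j → + 0 < i
0<i*j⇒0<i {j = j} 0<ij 0<j = ℤ.*-cancelʳ-<-nonNeg {+ 0} j {{nonNegative (ℤ.<⇒≤ 0<j)}} 0<ij

0≤i⇒i≡0⊎0<i : ∀ {i} → + 0 ≤ i → i ≡ + 0 ⊎ + 0 < i
0≤i⇒i≡0⊎0<i {+ 0}     _ = inj₁ refl
0≤i⇒i≡0⊎0<i {+ suc n} _ = inj₂ (+<+ (s≤s z≤n))

i<i+1 : ∀ i → i < i + + 1
i<i+1 i = ℤ.suc[i]≤j⇒i<j (ℤ.≤-reflexive (ℤ.+-comm (+ 1) i))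

square-mono-≤ : ∀ {i j} → + 0 ≤ i → i ≤ j → i * i ≤ j * j
square-mono-≤ {i} {j} 0≤i i≤j = ℤ.≤-trans
  (ℤ.*-monoˡ-≤-nonNeg i {{nonNegative 0≤i}} i≤j)
  (ℤ.*-monoʳ-≤-nonNeg j {{nonNegative (ℤ.≤-trans 0≤i i≤j)}} i≤j)

square-mono-< : ∀ {i j} → + 0 ≤ i → i < j → i * i < j * j
square-mono-< {i} {j} 0≤i i<j = ℤ.≤-<-trans
  (ℤ.*-monoˡ-≤-nonNeg i {{nonNegative 0≤i}} (ℤ.<⇒≤ i<j))
  (ℤ.*-monoʳ-<-pos j {{positive (ℤ.≤-<-trans 0≤i i<j)}} i<j)

square-injective : ∀ {i j} → + 0 ≤ i → + 0 ≤ j → i * i ≡ j * j → i ≡ j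
square-injective {i} {j} 0≤i 0≤j i²≡j² with ℤ.<-cmp i j
... | tri< i<j _ _ = ⊥-elim (ℤ.<-irrefl i²≡j² (square-mono-< 0≤i i<j))
... | tri≈ _ i≡j _ = i≡j
... | tri> _ _ j<i = ⊥-elim (ℤ.<-irrefl (sym i²≡j²) (square-mono-< 0≤j j<i))

i*i≡j*j⇒i≡j∨i≡-j : ∀ i j → i * i ≡ j * j → i ≡ j ⊎ i ≡ - j
i*i≡j*j⇒i≡j∨i≡-j i j i²≡j² with ℤ.i*j≡0⇒i≡0∨j≡0 (i - j) (begin
  (i - j) * (i + j) ≡⟨ solve (i ∷ j ∷ []) ⟩
  i * i - j * j     ≡⟨ ℤ.i≡j⇒i-j≡0 i²≡j² ⟩
  + 0               ∎)
... | inj₁ i-j≡0 = inj₁ (ℤ.i-j≡0⇒i≡j i j i-j≡0)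
... | inj₂ i+j≡0 = inj₂ (begin
  i           ≡⟨ solve (i ∷ j ∷ []) ⟩
  i + j - j   ≡⟨ cong (_- j) i+j≡0 ⟩
  + 0 - j     ≡⟨ ℤ.+-identityˡ (- j) ⟩
  - j         ∎)

NonNegRoot : ℤ → Set
NonNegRoot v = ∃ λ r → + 0 ≤ r × r * r ≡ v

nonNegRoot : ∀ {v} → IsSquare v → NonNegRoot v
nonNegRoot (+ n , n²≡v)       = + n , +≤+ z≤n , n²≡v
nonNegRoot (-[1+ n ] , n²≡v) = + suc n , +≤+ z≤n , n²≡v

i*i+1-nonSquare : ∀ {i} → + 0 < i → ¬ IsSquare (i * i + + 1)
i*i+1-nonSquare {i} 0<i sq with nonNegRoot sq
... | r , 0≤r , r²≡ with r ≤? i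
...   | yes r≤i = ℤ.<-irrefl r²≡ (ℤ.≤-<-trans (square-mono-≤ 0≤r r≤i) (i<i+1 (i * i)))
...   | no r≰i  = ℤ.<-irrefl (sym r²≡) (ℤ.<-≤-trans i²+1<[i+1]² [i+1]²≤r²)
  where
  i²+1<[i+1]² : i * i + + 1 < (i + + 1) * (i + + 1)
  i²+1<[i+1]² = subst₂ _<_ (ℤ.+-identityʳ _) expand (ℤ.+-monoʳ-< (i * i + + 1) (ℤ.+-mono-< 0<i 0<i))
    where
    expand : i * i + + 1 + (i + i) ≡ (i + + 1) * (i + + 1)
    expand = solve (i ∷ [])
  [i+1]²≤r² : (i + + 1) * (i + + 1) ≤ r * r
  [i+1]²≤r² = square-mono-≤ (ℤ.<⇒≤ (ℤ.<-trans 0<i (i<i+1 i)))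
    (subst (_≤ r) (ℤ.+-comm (+ 1) i) (ℤ.i<j⇒suc[i]≤j (ℤ.≰⇒> r≰i)))

3-nonSquare : ¬ IsSquare (+ 3)
3-nonSquare sq with nonNegRoot sq
... | + 0 , _ , ()
... | + 1 , _ , ()
... | + suc (suc k) , _ , r²≡3 =
  ℤ.<⇒≱ (+<+ (s≤s (s≤s (s≤s (s≤s z≤n)))))
    (subst (+ 4 ≤_) r²≡3 (square-mono-≤ {+ 2} (+≤+ z≤n) (+≤+ (s≤s (s≤s z≤n)))))

3≤i*j : ∀ {i j} → + 0 < i → + 0 < j → i ≢ j → IsSquare (i * j + + 1) → + 3 ≤ i * j
3≤i*j {+ 0} (+<+ ()) _ _ _
3≤i*j {_} {+ 0} _ (+<+ ()) _ _
3≤i*j { -[1+ _ ]} () _ _ _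
3≤i*j {_} { -[1+ _ ]} _ () _ _
3≤i*j {+ 1} {+ 1} _ _ i≢j _ = ⊥-elim (i≢j refl)
3≤i*j {+ 1} {+ 2} _ _ _ sq = ⊥-elim (3-nonSquare sq)
3≤i*j {+ 2} {+ 1} _ _ _ sq = ⊥-elim (3-nonSquare sq)
3≤i*j {+ 1} {+ suc (suc (suc n))} _ _ _ _ = +≤+ (s≤s (s≤s (s≤s z≤n)))
3≤i*j {+ suc (suc (suc m))} {+ 1} _ _ _ _ = +≤+ (s≤s (s≤s (s≤s z≤n)))
3≤i*j {+ suc (suc m)} {+ suc (suc n)} _ _ _ _ =
  +≤+ (ℕ.≤-trans (ℕ.n≤1+n 3) (ℕ.*-mono-≤ {2} {suc (suc m)} {2} {suc (suc n)} (s≤s (s≤s z≤n)) (s≤s (s≤s z≤n))))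

IsDiophTriple-rotate : ∀ {a b c} → IsDiophTriple (a , b , c) → IsDiophTriple (b , c , a)
IsDiophTriple-rotate {a} {b} {c} (0<a , 0<b , 0<c , a≢b , a≢c , b≢c , sab , sac , sbc) =
  0<b , 0<c , 0<a , b≢c , (λ b≡a → a≢b (sym b≡a)) , (λ c≡a → a≢c (sym c≡a)) ,
  sbc , subst IsSquare (cong (_+ + 1) (ℤ.*-comm a b)) sab ,
  subst IsSquare (cong (_+ + 1) (ℤ.*-comm a c)) sac

IsDiophTriple-swap : ∀ {a b c} → IsDiophTriple (a , b , c) → IsDiophTriple (a , c , b)
IsDiophTriple-swap {a} {b} {c} (0<a , 0<b , 0<c , a≢b , a≢c , b≢c , sab , sac , sbc) =
  0<a , 0<c , 0<b , a≢c , a≢b , (λ c≡b → b≢c (sym c≡b)) ,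
  sac , sab , subst IsSquare (cong (_+ + 1) (ℤ.*-comm b c)) sbc

DMinus-rotate : ∀ {a b c d} → DMinus (a , b , c) d → DMinus (b , c , a) d
DMinus-rotate {a} {b} {c} (m , 0≤m , m² , d≡) =
  m , 0≤m , trans m² (solve (a ∷ b ∷ c ∷ [])) , trans d≡ (solve (a ∷ b ∷ c ∷ m ∷ []))

DMinus-swap : ∀ {a b c d} → DMinus (a , b , c) d → DMinus (a , c , b) d
DMinus-swap {a} {b} {c} (m , 0≤m , m² , d≡) =
  m , 0≤m , trans m² (solve (a ∷ b ∷ c ∷ [])) , trans d≡ (solve (a ∷ b ∷ c ∷ m ∷ []))

-- The Diophantine quadruple {a, b, c, d₋}

DMinus-unique : ∀ {T d₁ d₂} → DMinus T d₁ → DMinus T d₂ → d₁ ≡ d₂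
DMinus-unique {a , b , c} (m₁ , 0≤m₁ , m₁² , d₁≡) (m₂ , 0≤m₂ , m₂² , d₂≡) =
  trans d₁≡ (trans (cong (λ m → a + b + c + + 2 * a * b * c - + 2 * m) m₁≡m₂) (sym d₂≡))
  where
  m₁≡m₂ : m₁ ≡ m₂
  m₁≡m₂ = square-injective 0≤m₁ 0≤m₂ (trans m₁² (sym m₂²))

rootProduct-square : ∀ {a b c} r s t → r * r ≡ a * b + + 1 → s * s ≡ a * c + + 1 → t * t ≡ b * c + + 1 →
  r * s * t * (r * s * t) ≡ (a * b + + 1) * (a * c + + 1) * (b * c + + 1)
rootProduct-square r s t r² s² t² = begin
  r * s * t * (r * s * t)     ≡⟨ solve (r ∷ s ∷ t ∷ []) ⟩
  r * r * (s * s) * (t * t)   ≡⟨ cong₂ _*_ (cong₂ _*_ r² s²) t² ⟩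
  _                           ∎

DMinus-exists : ∀ {T} → IsDiophTriple T → ∃ (DMinus T)
DMinus-exists {a , b , c} (_ , _ , _ , _ , _ , _ , sab , sac , sbc)
  with nonNegRoot sab | nonNegRoot sac | nonNegRoot sbc
... | r , 0≤r , r² | s , 0≤s , s² | t , 0≤t , t² =
  _ , r * s * t , 0≤i*j (0≤i*j 0≤r 0≤s) 0≤t , rootProduct-square {a} {b} {c} r s t r² s² t² , refl

DMinus-viaRoots : ∀ {a b c d r s t} → + 0 ≤ r → + 0 ≤ s → + 0 ≤ t →
  r * r ≡ a * b + + 1 → s * s ≡ a * c + + 1 → t * t ≡ b * c + + 1 → DMinus (a , b , c) d →
  d ≡ a + b + c + + 2 * a * b * c - + 2 * (r * s * t)
DMinus-viaRoots {a} {b} {c} {r = r} {s} {t} 0≤r 0≤s 0≤t r² s² t² (m , 0≤m , m² , d≡) =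
  trans d≡ (cong (λ u → a + b + c + + 2 * a * b * c - + 2 * u)
    (square-injective 0≤m (0≤i*j (0≤i*j 0≤r 0≤s) 0≤t) (trans m² (sym (rootProduct-square {a} {b} {c} r s t r² s² t²)))))

DMinus-square : ∀ {a b c d} → IsDiophTriple (a , b , c) → DMinus (a , b , c) d → IsSquare (a * d + + 1)
DMinus-square {a} {b} {c} {d} (_ , _ , _ , _ , _ , _ , sab , sac , sbc) dm
  with nonNegRoot sab | nonNegRoot sac | nonNegRoot sbc
... | r , 0≤r , r² | s , 0≤s , s² | t , 0≤t , t² = a * t - r * s , (begin
  (a * t - r * s) * (a * t - r * s)
    ≡⟨ solve (a ∷ r ∷ s ∷ t ∷ []) ⟩
  a * a * (t * t) + r * r * (s * s) - + 2 * a * (r * s * t)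
    ≡⟨ cong₂ (λ u v → a * a * u + v - + 2 * a * (r * s * t)) t² (cong₂ _*_ r² s²) ⟩
  a * a * (b * c + + 1) + (a * b + + 1) * (a * c + + 1) - + 2 * a * (r * s * t)
    ≡⟨ solve (a ∷ b ∷ c ∷ r ∷ s ∷ t ∷ []) ⟩
  a * (a + b + c + + 2 * a * b * c - + 2 * (r * s * t)) + + 1
    ≡⟨ cong (λ u → a * u + + 1) (sym (DMinus-viaRoots {a} {b} {c} 0≤r 0≤s 0≤t r² s² t² dm)) ⟩
  a * d + + 1 ∎)

0≤i*d+1⇒i≡1 : ∀ {i n} → + 0 < i → + 0 ≤ i * -[1+ n ] + + 1 → i ≡ + 1
0≤i*d+1⇒i≡1 {i} {n} 0<i 0≤id+1 = ℤ.≤-antisym i≤1 (ℤ.i<j⇒suc[i]≤j 0<i)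
  where
  id≤-i : i * -[1+ n ] ≤ - i
  id≤-i = subst (i * -[1+ n ] ≤_) (solve (i ∷ []))
    (ℤ.*-monoˡ-≤-nonNeg i {{nonNegative (ℤ.<⇒≤ 0<i)}} (-≤- z≤n))
  i≤1 : i ≤ + 1
  i≤1 = ℤ.0≤i-j⇒j≤i (subst (+ 0 ≤_) (ℤ.+-comm (- i) (+ 1))
    (ℤ.≤-trans 0≤id+1 (ℤ.+-monoˡ-≤ (+ 1) id≤-i)))

0≤d-fromSquares : ∀ {i j d} → + 0 < i → + 0 < j → i ≢ j →
  IsSquare (i * d + + 1) → IsSquare (j * d + + 1) → + 0 ≤ d
0≤d-fromSquares {d = + n} _ _ _ _ _ = +≤+ z≤n
0≤d-fromSquares {d = -[1+ n ]} 0<i 0<j i≢j si sj =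
  ⊥-elim (i≢j (trans (0≤i*d+1⇒i≡1 0<i (nonNeg si)) (sym (0≤i*d+1⇒i≡1 0<j (nonNeg sj)))))
  where
  nonNeg : ∀ {v} → IsSquare v → + 0 ≤ v
  nonNeg (r , r²≡v) = subst (+ 0 ≤_) r²≡v (0≤i*i r)

DMinus-nonNeg : ∀ {T d} → IsDiophTriple T → DMinus T d → + 0 ≤ d
DMinus-nonNeg {a , b , c} dt@(0<a , 0<b , _ , a≢b , _) dm =
  0≤d-fromSquares 0<a 0<b a≢b (DMinus-square {a} {b} {c} dt dm)
    (DMinus-square {b} {c} {a} (IsDiophTriple-rotate {a} {b} {c} dt) (DMinus-rotate {a} {b} {c} dm))

squareShift⇒≢ : ∀ {i d} → + 0 < i → IsSquare (i * d + + 1) → i ≢ d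
squareShift⇒≢ {i} 0<i sq refl = i*i+1-nonSquare 0<i sq

-- Euler triples

irregularity : ℤ → ℤ → ℤ → ℤ
irregularity a b c = a * a + b * b + c * c - + 2 * a * b - + 2 * a * c - + 2 * b * c - + 4

dMinus*dPlus≡irregularity : ∀ a b c m → m * m ≡ (a * b + + 1) * (a * c + + 1) * (b * c + + 1) →
  (a + b + c + + 2 * a * b * c - + 2 * m) * (a + b + c + + 2 * a * b * c + + 2 * m) ≡ irregularity a b c
dMinus*dPlus≡irregularity a b c m m² = begin
  (a + b + c + + 2 * a * b * c - + 2 * m) * (a + b + c + + 2 * a * b * c + + 2 * m)
    ≡⟨ solve (a ∷ b ∷ c ∷ m ∷ []) ⟩
  (a + b + c + + 2 * a * b * c) * (a + b + c + + 2 * a * b * c) - + 4 * (m * m)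
    ≡⟨ cong (λ u → (a + b + c + + 2 * a * b * c) * (a + b + c + + 2 * a * b * c) - + 4 * u) m² ⟩
  (a + b + c + + 2 * a * b * c) * (a + b + c + + 2 * a * b * c) - + 4 * ((a * b + + 1) * (a * c + + 1) * (b * c + + 1))
    ≡⟨ solve (a ∷ b ∷ c ∷ []) ⟩
  a * a + b * b + c * c - + 2 * a * b - + 2 * a * c - + 2 * b * c - + 4 ∎

0<dPlus : ∀ {a b c m} → + 0 < a → + 0 < b → + 0 < c → + 0 ≤ m → + 0 < a + b + c + + 2 * a * b * c + + 2 * m
0<dPlus 0<a 0<b 0<c 0≤m =
  ℤ.+-mono-<-≤ (ℤ.+-mono-<-≤ (ℤ.+-mono-<-≤ (ℤ.+-mono-<-≤ 0<a (ℤ.<⇒≤ 0<b)) (ℤ.<⇒≤ 0<c))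
    (ℤ.<⇒≤ (0<i*j (0<i*j (0<i*j (ℤ.positive⁻¹ (+ 2)) 0<a) 0<b) 0<c)))
    (0≤i*j (ℤ.nonNegative⁻¹ (+ 2)) 0≤m)

irregularity-viaPair : ∀ x y z → irregularity x y z ≡ (z - x - y) * (z - x - y) - + 4 * (x * y + + 1)
irregularity-viaPair x y z = begin
  irregularity x y z                                                   ≡⟨⟩
  x * x + y * y + z * z - + 2 * x * y - + 2 * x * z - + 2 * y * z - + 4 ≡⟨ solve (x ∷ y ∷ z ∷ []) ⟩
  (z - x - y) * (z - x - y) - + 4 * (x * y + + 1)                       ∎

irregularity-swap : ∀ a b c → irregularity a b c ≡ irregularity a c b
irregularity-swap a b c = begin
  a * a + b * b + c * c - + 2 * a * b - + 2 * a * c - + 2 * b * c - + 4 ≡⟨ solve (a ∷ b ∷ c ∷ []) ⟩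
  a * a + c * c + b * b - + 2 * a * c - + 2 * a * b - + 2 * c * b - + 4 ∎

irregularity-rotate : ∀ a b c → irregularity a b c ≡ irregularity b c a
irregularity-rotate a b c = begin
  a * a + b * b + c * c - + 2 * a * b - + 2 * a * c - + 2 * b * c - + 4 ≡⟨ solve (a ∷ b ∷ c ∷ []) ⟩
  b * b + c * c + a * a - + 2 * b * c - + 2 * b * a - + 2 * c * a - + 4 ∎

EulerForm⇒irregularity≡0 : ∀ {x y z} → EulerForm x y z → irregularity x y z ≡ + 0
EulerForm⇒irregularity≡0 {x} {y} {z} (ρ , _ , ρ² , z≡) = begin
  irregularity x y z                                               ≡⟨ irregularity-viaPair x y z ⟩
  (z - x - y) * (z - x - y) - + 4 * (x * y + + 1)                   ≡⟨ cong₂ (λ u v → (u - x - y) * (u - x - y) - + 4 * v) z≡ (sym ρ²) ⟩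
  (x + y + + 2 * ρ - x - y) * (x + y + + 2 * ρ - x - y) - + 4 * (ρ * ρ) ≡⟨ solve (x ∷ y ∷ ρ ∷ []) ⟩
  + 0                                                                ∎

Euler⇒irregularity≡0 : ∀ {a b c} → IsEuler (a , b , c) → irregularity a b c ≡ + 0
Euler⇒irregularity≡0 {a} {b} {c} (_ , inj₁ f) = EulerForm⇒irregularity≡0 {a} {b} {c} f
Euler⇒irregularity≡0 {a} {b} {c} (_ , inj₂ (inj₁ f)) = trans (irregularity-swap a b c) (EulerForm⇒irregularity≡0 {a} {c} {b} f)
Euler⇒irregularity≡0 {a} {b} {c} (_ , inj₂ (inj₂ f)) = trans (irregularity-rotate a b c) (EulerForm⇒irregularity≡0 {b} {c} {a} f)

irregularity≡0⇒EulerForm⊎ : ∀ {x y z ρ} → + 0 ≤ ρ → ρ * ρ ≡ x * y + + 1 → irregularity x y z ≡ + 0 →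
  EulerForm x y z ⊎ z - x - y ≡ - (+ 2 * ρ)
irregularity≡0⇒EulerForm⊎ {x} {y} {z} {ρ} 0≤ρ ρ² Q≡0
  with i*i≡j*j⇒i≡j∨i≡-j (z - x - y) (+ 2 * ρ) (begin
    (z - x - y) * (z - x - y) ≡⟨ ℤ.i-j≡0⇒i≡j _ _ (trans (sym (irregularity-viaPair x y z)) Q≡0) ⟩
    + 4 * (x * y + + 1)       ≡⟨ cong (+ 4 *_) (sym ρ²) ⟩
    + 4 * (ρ * ρ)             ≡⟨ solve (ρ ∷ []) ⟩
    + 2 * ρ * (+ 2 * ρ)       ∎)
... | inj₁ z-x-y≡2ρ = inj₁ (ρ , 0≤ρ , ρ² , (begin
  z                   ≡⟨ solve (x ∷ y ∷ z ∷ []) ⟩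
  x + y + (z - x - y) ≡⟨ cong (_+_ (x + y)) z-x-y≡2ρ ⟩
  x + y + + 2 * ρ     ∎))
... | inj₂ z-x-y≡-2ρ = inj₂ z-x-y≡-2ρ

-- If all three differences took the negative root, then a = r + s and b = r + t,
-- so ab + 1 = r² would exceed r².
¬allNegativeRoots : ∀ {a b c r s t} → + 0 ≤ r → + 0 ≤ s → + 0 ≤ t → r * r ≡ a * b + + 1 →
  c - a - b ≡ - (+ 2 * r) → b - a - c ≡ - (+ 2 * s) → a - b - c ≡ - (+ 2 * t) → ⊥
¬allNegativeRoots {a} {b} {c} {r} {s} {t} 0≤r 0≤s 0≤t r² e₁ e₂ e₃ =
  ℤ.<-irrefl 4r²≡4r²+k (subst (_< + 4 * (r * r) + k) (ℤ.+-identityʳ (+ 4 * (r * r))) (ℤ.+-monoʳ-< (+ 4 * (r * r)) 0<k))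
  where
  k : ℤ
  k = + 4 * (r * t + r * s + s * t + + 1)
  0<k : + 0 < k
  0<k = 0<i*j (ℤ.positive⁻¹ (+ 4))
    (ℤ.+-mono-≤-< (ℤ.+-mono-≤ (ℤ.+-mono-≤ (0≤i*j 0≤r 0≤t) (0≤i*j 0≤r 0≤s)) (0≤i*j 0≤s 0≤t)) (ℤ.positive⁻¹ (+ 1)))
  4r²≡4r²+k : + 4 * (r * r) ≡ + 4 * (r * r) + k
  4r²≡4r²+k = begin
    + 4 * (r * r)        ≡⟨ cong (+ 4 *_) r² ⟩
    + 4 * (a * b + + 1)  ≡⟨ solve (a ∷ b ∷ c ∷ []) ⟩
    ((c - a - b) + (b - a - c)) * ((c - a - b) + (a - b - c)) + + 4
      ≡⟨ cong (_+ + 4) (cong₂ _*_ (cong₂ _+_ e₁ e₂) (cong₂ _+_ e₁ e₃)) ⟩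
    (- (+ 2 * r) + - (+ 2 * s)) * (- (+ 2 * r) + - (+ 2 * t)) + + 4 ≡⟨ solve (r ∷ s ∷ t ∷ []) ⟩
    + 4 * (r * r) + + 4 * (r * t + r * s + s * t + + 1) ∎

irregularity≡0⇒Euler : ∀ {a b c} → IsDiophTriple (a , b , c) → irregularity a b c ≡ + 0 → IsEuler (a , b , c)
irregularity≡0⇒Euler {a} {b} {c} dt@(_ , _ , _ , _ , _ , _ , sab , sac , sbc) Q≡0 =
  fromRoots (nonNegRoot sab) (nonNegRoot sac) (nonNegRoot sbc)
  where
  fromRoots : NonNegRoot (a * b + + 1) → NonNegRoot (a * c + + 1) → NonNegRoot (b * c + + 1) → IsEuler (a , b , c)
  fromRoots (r , 0≤r , r²) (s , 0≤s , s²) (t , 0≤t , t²) = select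
    (irregularity≡0⇒EulerForm⊎ {a} {b} {c} 0≤r r² Q≡0)
    (irregularity≡0⇒EulerForm⊎ {a} {c} {b} 0≤s s² (trans (sym (irregularity-swap a b c)) Q≡0))
    (irregularity≡0⇒EulerForm⊎ {b} {c} {a} 0≤t t² (trans (sym (irregularity-rotate a b c)) Q≡0))
    where
    select : EulerForm a b c ⊎ c - a - b ≡ - (+ 2 * r) → EulerForm a c b ⊎ b - a - c ≡ - (+ 2 * s) →
             EulerForm b c a ⊎ a - b - c ≡ - (+ 2 * t) → IsEuler (a , b , c)
    select (inj₁ f) _ _ = dt , inj₁ f
    select (inj₂ _) (inj₁ f) _ = dt , inj₂ (inj₁ f)
    select (inj₂ _) (inj₂ _) (inj₁ f) = dt , inj₂ (inj₂ f)
    select (inj₂ e₁) (inj₂ e₂) (inj₂ e₃) = ⊥-elim (¬allNegativeRoots {a} {b} {c} 0≤r 0≤s 0≤t r² e₁ e₂ e₃)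

Euler⇒DMinus≡0 : ∀ {T d} → IsEuler T → DMinus T d → d ≡ + 0
Euler⇒DMinus≡0 {a , b , c} {d} E@((0<a , 0<b , 0<c , _) , _) (m , 0≤m , m² , d≡) =
  [ id , (λ dPlus≡0 → ⊥-elim (ℤ.<-irrefl (sym dPlus≡0) (0<dPlus 0<a 0<b 0<c 0≤m))) ]′
    (ℤ.i*j≡0⇒i≡0∨j≡0 d d*dPlus≡0)
  where
  d*dPlus≡0 : d * (a + b + c + + 2 * a * b * c + + 2 * m) ≡ + 0
  d*dPlus≡0 = begin
    d * (a + b + c + + 2 * a * b * c + + 2 * m)
      ≡⟨ cong (_* (a + b + c + + 2 * a * b * c + + 2 * m)) d≡ ⟩
    (a + b + c + + 2 * a * b * c - + 2 * m) * (a + b + c + + 2 * a * b * c + + 2 * m)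
      ≡⟨ dMinus*dPlus≡irregularity a b c m m² ⟩
    irregularity a b c
      ≡⟨ Euler⇒irregularity≡0 {a} {b} {c} E ⟩
    + 0 ∎

DMinus≡0⇒Euler : ∀ {T} → IsDiophTriple T → DMinus T (+ 0) → IsEuler T
DMinus≡0⇒Euler {a , b , c} dt (m , _ , m² , 0≡d) = irregularity≡0⇒Euler {a} {b} {c} dt (begin
  irregularity a b c
    ≡⟨ sym (dMinus*dPlus≡irregularity a b c m m²) ⟩
  (a + b + c + + 2 * a * b * c - + 2 * m) * (a + b + c + + 2 * a * b * c + + 2 * m)
    ≡⟨ cong (_* (a + b + c + + 2 * a * b * c + + 2 * m)) (sym 0≡d) ⟩
  + 0 ∎)

DMinus-pos : ∀ {T d} → IsDiophTriple T → ¬ IsEuler T → DMinus T d → + 0 < d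
DMinus-pos {T} dt ¬E dm = [ (λ d≡0 → ⊥-elim (¬E (DMinus≡0⇒Euler dt (subst (DMinus T) d≡0 dm)))) , id ]′
  (0≤i⇒i≡0⊎0<i (DMinus-nonNeg dt dm))

-- Replacing the largest element by d₋

xyz≤root : ∀ {x y z m} → + 0 < x → + 0 < y → + 0 < z → + 0 ≤ m →
  m * m ≡ (x * y + + 1) * (x * z + + 1) * (y * z + + 1) → x * y * z ≤ m
xyz≤root {x} {y} {z} {m} 0<x 0<y 0<z 0≤m m² =
  ℤ.≮⇒≥ (λ m<xyz → ℤ.<⇒≱ (square-mono-< 0≤m m<xyz) [xyz]²≤m²)
  where
  0≤x = ℤ.<⇒≤ 0<x ; 0≤y = ℤ.<⇒≤ 0<y ; 0≤z = ℤ.<⇒≤ 0<z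
  excess : ℤ
  excess = x * y * z * (x + y + z) + x * y + x * z + y * z + + 1
  0≤excess : + 0 ≤ excess
  0≤excess = ℤ.+-mono-≤ (ℤ.+-mono-≤ (ℤ.+-mono-≤ (ℤ.+-mono-≤
    (0≤i*j (0≤i*j (0≤i*j 0≤x 0≤y) 0≤z) (ℤ.+-mono-≤ (ℤ.+-mono-≤ 0≤x 0≤y) 0≤z))
    (0≤i*j 0≤x 0≤y)) (0≤i*j 0≤x 0≤z)) (0≤i*j 0≤y 0≤z)) (ℤ.nonNegative⁻¹ (+ 1))
  [xyz]²≤m² : x * y * z * (x * y * z) ≤ m * m
  [xyz]²≤m² = subst (x * y * z * (x * y * z) ≤_) (sym m²≡[xyz]²+excess)
    (ℤ.i≤i+j (x * y * z * (x * y * z)) excess {{nonNegative 0≤excess}})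
    where
    m²≡[xyz]²+excess : m * m ≡ x * y * z * (x * y * z) + (x * y * z * (x + y + z) + x * y + x * z + y * z + + 1)
    m²≡[xyz]²+excess = trans m² (solve (x ∷ y ∷ z ∷ []))

-- Via d₋·d₊ = irregularity; when x, y < z every summand on the right is ≥ 0, and z·x > 0.
[z-4xyd]*dPlus : ∀ {x y z m d} → m * m ≡ (x * y + + 1) * (x * z + + 1) * (y * z + + 1) →
  d ≡ x + y + z + + 2 * x * y * z - + 2 * m →
  (z - + 4 * x * y * d) * (x + y + z + + 2 * x * y * z + + 2 * m)
  ≡ + 2 * z * (m - x * y * z) + z * x + z * y + z * z + + 4 * x * y * (x * (z - x) + y * (z - y) + x * z + y * z + + 2 * x * y + + 4)
[z-4xyd]*dPlus {x} {y} {z} {m} {d} m² d≡ = begin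
  (z - + 4 * x * y * d) * (x + y + z + + 2 * x * y * z + + 2 * m)
    ≡⟨ cong (λ u → (z - + 4 * x * y * u) * (x + y + z + + 2 * x * y * z + + 2 * m)) d≡ ⟩
  (z - + 4 * x * y * (x + y + z + + 2 * x * y * z - + 2 * m)) * (x + y + z + + 2 * x * y * z + + 2 * m)
    ≡⟨ solve (x ∷ y ∷ z ∷ m ∷ []) ⟩
  z * (x + y + z + + 2 * x * y * z + + 2 * m)
    - + 4 * x * y * ((x + y + z + + 2 * x * y * z - + 2 * m) * (x + y + z + + 2 * x * y * z + + 2 * m))
    ≡⟨ cong (λ u → z * (x + y + z + + 2 * x * y * z + + 2 * m) - + 4 * x * y * u) (dMinus*dPlus≡irregularity x y z m m²) ⟩
  z * (x + y + z + + 2 * x * y * z + + 2 * m)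
    - + 4 * x * y * (x * x + y * y + z * z - + 2 * x * y - + 2 * x * z - + 2 * y * z - + 4)
    ≡⟨ solve (x ∷ y ∷ z ∷ m ∷ []) ⟩
  + 2 * z * (m - x * y * z) + z * x + z * y + z * z + + 4 * x * y * (x * (z - x) + y * (z - y) + x * z + y * z + + 2 * x * y + + 4) ∎

0<i-j⇒j<i : ∀ {i j} → + 0 < i - j → j < i
0<i-j⇒j<i 0<i-j = ℤ.≰⇒> (λ i≤j → ℤ.<⇒≱ 0<i-j (ℤ.i≤j⇒i-j≤0 i≤j))

4xyDMinus<max : ∀ {x y z d} → IsDiophTriple (x , y , z) → x < z → y < z → DMinus (x , y , z) d → + 4 * x * y * d < z
4xyDMinus<max {x} {y} {z} {d} (0<x , 0<y , 0<z , _) x<z y<z (m , 0≤m , m² , d≡) =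
  0<i-j⇒j<i (0<i*j⇒0<i (subst (+ 0 <_) (sym ([z-4xyd]*dPlus {x} {y} {z} {m} {d} m² d≡)) 0<rhs) (0<dPlus 0<x 0<y 0<z 0≤m))
  where
  0≤x = ℤ.<⇒≤ 0<x ; 0≤y = ℤ.<⇒≤ 0<y ; 0≤z = ℤ.<⇒≤ 0<z
  0≤W : + 0 ≤ x * (z - x) + y * (z - y) + x * z + y * z + + 2 * x * y + + 4
  0≤W = ℤ.+-mono-≤ (ℤ.+-mono-≤ (ℤ.+-mono-≤ (ℤ.+-mono-≤ (ℤ.+-mono-≤
    (0≤i*j 0≤x (ℤ.i≤j⇒0≤j-i (ℤ.<⇒≤ x<z))) (0≤i*j 0≤y (ℤ.i≤j⇒0≤j-i (ℤ.<⇒≤ y<z))))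
    (0≤i*j 0≤x 0≤z)) (0≤i*j 0≤y 0≤z)) (0≤i*j (0≤i*j (ℤ.nonNegative⁻¹ (+ 2)) 0≤x) 0≤y)) (ℤ.nonNegative⁻¹ (+ 4))
  0<rhs : + 0 < + 2 * z * (m - x * y * z) + z * x + z * y + z * z + + 4 * x * y * (x * (z - x) + y * (z - y) + x * z + y * z + + 2 * x * y + + 4)
  0<rhs = ℤ.+-mono-<-≤ (ℤ.+-mono-<-≤ (ℤ.+-mono-<-≤
    (ℤ.+-mono-≤-< (0≤i*j (0≤i*j (ℤ.nonNegative⁻¹ (+ 2)) 0≤z) (ℤ.i≤j⇒0≤j-i (xyz≤root 0<x 0<y 0<z 0≤m m²))) (0<i*j 0<z 0<x))
    (0≤i*j 0≤z 0≤y)) (0≤i*j 0≤z 0≤z)) (0≤i*j (0≤i*j (0≤i*j (ℤ.nonNegative⁻¹ (+ 4)) 0≤x) 0≤y) 0≤W)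

12*DMinus≤max : ∀ {x y z d} → IsDiophTriple (x , y , z) → x < z → y < z → DMinus (x , y , z) d → + 12 * d ≤ z
12*DMinus≤max {x} {y} {z} {d} dt@(0<x , 0<y , _ , x≢y , _ , _ , sxy , _) x<z y<z dm =
  ℤ.≤-trans (ℤ.*-monoʳ-≤-nonNeg d {{nonNegative (DMinus-nonNeg {x , y , z} dt dm)}} 12≤4xy) (ℤ.<⇒≤ (4xyDMinus<max dt x<z y<z dm))
  where
  12≤4xy : + 12 ≤ + 4 * x * y
  12≤4xy = subst (+ 12 ≤_) (sym (ℤ.*-assoc (+ 4) x y)) (ℤ.*-monoˡ-≤-nonNeg (+ 4) (3≤i*j 0<x 0<y x≢y sxy))

tripleProduct : Triple → ℤ
tripleProduct (a , b , c) = a * b * c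

replaceMax : ∀ {x y z d} → IsDiophTriple (x , y , z) → x < z → y < z → DMinus (x , y , z) d → + 0 < d →
  IsDiophTriple (x , y , d) × + 12 * (x * y * d) ≤ x * y * z
replaceMax {x} {y} {z} {d} dt@(0<x , 0<y , _ , x≢y , _ , _ , sxy , _) x<z y<z dm 0<d =
  (0<x , 0<y , 0<d , x≢y , squareShift⇒≢ 0<x sxd , squareShift⇒≢ 0<y syd , sxy , sxd , syd) ,
  subst (_≤ x * y * z) 12xyd≡ (ℤ.*-monoˡ-≤-nonNeg (x * y) {{nonNegative (ℤ.<⇒≤ (0<i*j 0<x 0<y))}} (12*DMinus≤max dt x<z y<z dm))
  where
  12xyd≡ : x * y * (+ 12 * d) ≡ + 12 * (x * y * d)
  12xyd≡ = solve (x ∷ y ∷ d ∷ [])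
  sxd : IsSquare (x * d + + 1)
  sxd = DMinus-square {x} {y} {z} dt dm
  syd : IsSquare (y * d + + 1)
  syd = DMinus-square {y} {z} {x} (IsDiophTriple-rotate {x} {y} {z} dt) (DMinus-rotate {x} {y} {z} dm)

removeMax-cases : ∀ a b c d → a ≢ b → a ≢ c → b ≢ c →
  (b < a × c < a × removeMax (a , b , c) d ≡ (b , c , d)) ⊎
  (a < b × c < b × removeMax (a , b , c) d ≡ (a , c , d)) ⊎
  (a < c × b < c × removeMax (a , b , c) d ≡ (a , b , d))
removeMax-cases a b c d a≢b a≢c b≢c with b ≤? a | c ≤? a | a ≤? b | c ≤? b
... | yes b≤a | yes c≤a | _ | _ =
  inj₁ (ℤ.≤∧≢⇒< b≤a (λ b≡a → a≢b (sym b≡a)) , ℤ.≤∧≢⇒< c≤a (λ c≡a → a≢c (sym c≡a)) , refl)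
... | yes b≤a | no _ | yes a≤b | _ = ⊥-elim (a≢b (ℤ.≤-antisym a≤b b≤a))
... | yes b≤a | no c≰a | no _ | _ = inj₂ (inj₂ (ℤ.≰⇒> c≰a , ℤ.≤-<-trans b≤a (ℤ.≰⇒> c≰a) , refl))
... | no b≰a | _ | yes _ | yes c≤b = inj₂ (inj₁ (ℤ.≰⇒> b≰a , ℤ.≤∧≢⇒< c≤b (λ c≡b → b≢c (sym c≡b)) , refl))
... | no b≰a | _ | yes _ | no c≰b = inj₂ (inj₂ (ℤ.<-trans (ℤ.≰⇒> b≰a) (ℤ.≰⇒> c≰b) , ℤ.≰⇒> c≰b , refl))
... | no b≰a | _ | no a≰b | _ = ⊥-elim (a≰b (ℤ.<⇒≤ (ℤ.≰⇒> b≰a)))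

removeMax-descends : ∀ {T d} → IsDiophTriple T → DMinus T d → + 0 < d →
  IsDiophTriple (removeMax T d) × + 12 * tripleProduct (removeMax T d) ≤ tripleProduct T
removeMax-descends {a , b , c} {d} dt@(_ , _ , _ , a≢b , a≢c , b≢c , _) dm 0<d =
  fromCase (removeMax-cases a b c d a≢b a≢c b≢c)
  where
  Goal : Triple → Set
  Goal T′ = IsDiophTriple T′ × + 12 * tripleProduct T′ ≤ a * b * c
  reorder : ∀ {T′ p} → p ≡ a * b * c → IsDiophTriple T′ × + 12 * tripleProduct T′ ≤ p → Goal T′
  reorder p≡abc (dt′ , shrink) = dt′ , subst (_ ≤_) p≡abc shrink
  bca≡abc : b * c * a ≡ a * b * c
  bca≡abc = solve (a ∷ b ∷ c ∷ [])
  acb≡abc : a * c * b ≡ a * b * c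
  acb≡abc = solve (a ∷ b ∷ c ∷ [])
  fromCase : (b < a × c < a × removeMax (a , b , c) d ≡ (b , c , d)) ⊎
             (a < b × c < b × removeMax (a , b , c) d ≡ (a , c , d)) ⊎
             (a < c × b < c × removeMax (a , b , c) d ≡ (a , b , d)) → Goal (removeMax (a , b , c) d)
  fromCase (inj₁ (b<a , c<a , eq)) = subst Goal (sym eq) (reorder {b , c , d} bca≡abc
    (replaceMax {b} {c} {a} (IsDiophTriple-rotate {a} {b} {c} dt) b<a c<a (DMinus-rotate {a} {b} {c} dm) 0<d))
  fromCase (inj₂ (inj₁ (a<b , c<b , eq))) = subst Goal (sym eq) (reorder {a , c , d} acb≡abc
    (replaceMax {a} {c} {b} (IsDiophTriple-swap {a} {b} {c} dt) a<b c<b (DMinus-swap {a} {b} {c} dm) 0<d))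
  fromCase (inj₂ (inj₂ (a<c , b<c , eq))) = subst Goal (sym eq)
    (replaceMax {a} {b} {c} dt a<c b<c dm 0<d)

-- The descent ∂

Descent-deterministic : ∀ {D T T₁ T₂} → Descent D T T₁ → Descent D T T₂ → T₁ ≡ T₂
Descent-deterministic here here = refl
Descent-deterministic (step {T' = T′} p₁ _ dm₁) (step p₂ _ dm₂) with Descent-deterministic p₁ p₂
... | refl = cong (removeMax T′) (DMinus-unique {T′} dm₁ dm₂)

Descent-preserves-dioph : ∀ {D T T′} → Descent D T T′ → IsDiophTriple T → IsDiophTriple T′
Descent-preserves-dioph here dt = dt
Descent-preserves-dioph (step {T' = T′} p ¬E dm) dt =
  let dt′ = Descent-preserves-dioph p dt in proj₁ (removeMax-descends {T′} dt′ dm (DMinus-pos {T′} dt′ ¬E dm))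

Descent-stops-at-Euler : ∀ {D T₀ T} → Descent D T₀ T → IsEuler T →
  ∀ {D′ T′} → D ℕ.< D′ → ¬ Descent D′ T₀ T′
Descent-stops-at-Euler {D} p E {suc D′} D<1+D′ (step p′ ¬E _) with ℕ.m<1+n⇒m<n∨m≡n D<1+D′
... | inj₁ D<D′ = Descent-stops-at-Euler p E D<D′ p′
... | inj₂ refl = ¬E (subst IsEuler (Descent-deterministic p p′) E)

DMinusIter-zero-unique : ∀ {T₀ D D′} → IsDiophTriple T₀ →
  DMinusIter D T₀ (+ 0) → DMinusIter D′ T₀ (+ 0) → D′ ≡ D
DMinusIter-zero-unique {D = D} {D′} dt (T , p , dm) (T′ , p′ , dm′) with ℕ.<-cmp D′ D
... | tri< D′<D _ _ = ⊥-elim (Descent-stops-at-Euler p′ (DMinus≡0⇒Euler {T′} (Descent-preserves-dioph p′ dt) dm′) D′<D p)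
... | tri≈ _ D′≡D _ = D′≡D
... | tri> _ _ D<D′ = ⊥-elim (Descent-stops-at-Euler p (DMinus≡0⇒Euler {T} (Descent-preserves-dioph p dt) dm) D<D′ p′)

StopOrDescend : Triple → Set
StopOrDescend T = DMinus T (+ 0) ⊎
  Σ ℤ λ d → ¬ IsEuler T × DMinus T d × IsDiophTriple (removeMax T d) × + 12 * tripleProduct (removeMax T d) ≤ tripleProduct T

stop⊎descend : ∀ {T} → IsDiophTriple T → StopOrDescend T
stop⊎descend {T} dt = fromDMinus (DMinus-exists {T} dt)
  where
  fromDMinus : ∃ (DMinus T) → StopOrDescend T
  fromDMinus (d , dm) =
    [ (λ d≡0 → inj₁ (subst (DMinus T) d≡0 dm)) , (λ 0<d → inj₂ (d , ¬E 0<d , dm , removeMax-descends {T} dt dm 0<d)) ]′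
      (0≤i⇒i≡0⊎0<i (DMinus-nonNeg {T} dt dm))
    where
    ¬E : + 0 < d → ¬ IsEuler T
    ¬E 0<d E = ℤ.<-irrefl (sym (Euler⇒DMinus≡0 {T} E dm)) 0<d

1<tripleProduct : ∀ {T} → IsDiophTriple T → + 1 < tripleProduct T
1<tripleProduct {a , b , c} (0<a , 0<b , 0<c , a≢b , _ , _ , sab , _) =
  ℤ.<-≤-trans (+<+ (s≤s (s≤s z≤n))) (ℤ.≤-trans (3≤i*j 0<a 0<b a≢b sab)
    (subst (_≤ a * b * c) (ℤ.*-identityʳ (a * b))
      (ℤ.*-monoˡ-≤-nonNeg (a * b) {{nonNegative (0≤i*j (ℤ.<⇒≤ 0<a) (ℤ.<⇒≤ 0<b))}} (ℤ.i<j⇒suc[i]≤j 0<c))))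

0<tripleProduct : ∀ {T} → IsDiophTriple T → + 0 < tripleProduct T
0<tripleProduct {T} dt = ℤ.<-trans (ℤ.positive⁻¹ (+ 1)) (1<tripleProduct {T} dt)

k<k*p : ∀ {k p} → + 0 < k → + 1 < p → k < k * p
k<k*p {k} 0<k 1<p = subst (_< k * _) (ℤ.*-identityʳ k) (ℤ.*-monoˡ-<-pos k {{positive 0<k}} 1<p)

12^[1+D]*p′≤q : ∀ D {p p′ q} → + 12 * p′ ≤ p → + (12 ^ D) * p ≤ q → + (12 ^ suc D) * p′ ≤ q
12^[1+D]*p′≤q D {p} {p′} 12p′≤p 12^Dp≤q =
  ℤ.≤-trans (ℤ.≤-reflexive regroup) (ℤ.≤-trans (ℤ.*-monoˡ-≤-nonNeg (+ (12 ^ D)) 12p′≤p) 12^Dp≤q)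
  where
  regroup : + (12 ^ suc D) * p′ ≡ + (12 ^ D) * (+ 12 * p′)
  regroup = begin
    + (12 ^ suc D) * p′      ≡⟨ cong (_* p′) (trans (ℤ.pos-* 12 (12 ^ D)) (ℤ.*-comm (+ 12) (+ (12 ^ D)))) ⟩
    + (12 ^ D) * + 12 * p′   ≡⟨ ℤ.*-assoc (+ (12 ^ D)) (+ 12) p′ ⟩
    + (12 ^ D) * (+ 12 * p′) ∎

-- The fuel n bounds the current product, which drops by a factor 12 with each step.
DMinusIter-zero-reached : ∀ (n : ℕ) {T₀ T D} → Descent D T₀ T → IsDiophTriple T → tripleProduct T ≤ + n →
  + (12 ^ D) * tripleProduct T ≤ tripleProduct T₀ →
  Σ ℕ λ D′ → (+ (12 ^ D′) < tripleProduct T₀) × DMinusIter D′ T₀ (+ 0)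
DMinusIter-zero-reached zero {T = T} _ dt P≤0 _ = ⊥-elim (ℤ.<⇒≱ (0<tripleProduct {T} dt) P≤0)
DMinusIter-zero-reached (suc n) {T₀} {T} {D} p dt P≤1+n 12^DP≤P₀ = continue (stop⊎descend {T} dt)
  where
  Result : Set
  Result = Σ ℕ λ D′ → (+ (12 ^ D′) < tripleProduct T₀) × DMinusIter D′ T₀ (+ 0)
  continue : StopOrDescend T → Result
  continue (inj₁ dm) = D , ℤ.<-≤-trans (k<k*p (+<+ (ℕ.m^n>0 12 D)) (1<tripleProduct {T} dt)) 12^DP≤P₀ , T , p , dm
  continue (inj₂ (d , ¬E , dm , dt′ , 12P′≤P)) =
    DMinusIter-zero-reached n (step p ¬E dm) dt′ P′≤n (12^[1+D]*p′≤q D 12P′≤P 12^DP≤P₀)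
    where
    P′ : ℤ
    P′ = tripleProduct (removeMax T d)
    P′<P : P′ < tripleProduct T
    P′<P = ℤ.<-≤-trans (subst (_< + 12 * P′) (ℤ.*-identityˡ P′)
      (ℤ.*-monoʳ-<-pos P′ {{positive (0<tripleProduct {removeMax T d} dt′)}} {+ 1} {+ 12} (+<+ (s≤s (s≤s z≤n))))) 12P′≤P
    P′≤n : P′ ≤ + n
    P′≤n = ℤ.i<j⇒i≤pred[j] (ℤ.<-≤-trans P′<P P≤1+n)

DMinusIter-zero-exists : ∀ {T} → IsDiophTriple T → Σ ℕ λ D → (+ (12 ^ D) < tripleProduct T) × DMinusIter D T (+ 0)
DMinusIter-zero-exists {T} dt = DMinusIter-zero-reached ∣ tripleProduct T ∣ here dt
  (ℤ.≤-reflexive (sym (ℤ.0≤i⇒+∣i∣≡i (ℤ.<⇒≤ (0<tripleProduct {T} dt)))))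
  (ℤ.≤-reflexive (ℤ.*-identityˡ (tripleProduct T)))

proposition4p5 : (a b c : ℤ) → IsDiophTriple (a , b , c) →
    Σ ℕ λ D → ((+ (12 ^ D) < a * b * c) × DMinusIter D (a , b , c) (+ 0)) ×
      ((D' : ℕ) → (+ (12 ^ D') < a * b * c) → DMinusIter D' (a , b , c) (+ 0) → D' ≡ D)
proposition4p5 a b c dt with DMinusIter-zero-exists {a , b , c} dt
... | D , 12^D<abc , iter = D , (12^D<abc , iter) , λ D′ _ iter′ → DMinusIter-zero-unique {a , b , c} dt iter iter′
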